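{- Let $K$ be a quartic number field with a real quadratic subfield $L$, let $\eta\in K$ be a unit of degree $4$ over $\mathbb{Q}$ with $N_{K/\mathbb{Q}}(\eta)>0$ such that $\epsilon:=\eta^2$ is a unit of $L$, let $\bar\epsilon$ be the conjugate of $\epsilon$ in $L$ and $T=\epsilon+\bar\epsilon$. Fix a nonzero $\beta\in K$ and put $\alpha(k)=\beta\eta^k$. Let $W=\{w_1,w_2,w_3,w_4\}$ be the basis of $\beta\,\mathbb{Z}[\eta]$ given by $w_1=\beta\eta^2$, $w_2=\beta\eta^3-(T+1)\beta\eta^2$, $w_3=\beta$, $w_4=\beta\eta-\beta\eta^2$ (equivalently $\beta=w_3$, $\beta\eta=w_1+w_4$, $\beta\eta^2=w_1$, $\beta\eta^3=(T+1)w_1+w_2$). Write $\alpha(k)=x_1(k)w_1+\cdots+x_4(k)w_4$ and let $u_n=(\epsilon^n-\bar\epsilon^n)/(\epsilon-\bar\epsilon)$. Then for every integer $k\ge2$: $x_1(k)=u_n$ if $k=2n$ and $x_1(k)=u_{n+1}+u_n$ if $k=2n+1$; $x_2(k)=0$ if $k=2n$ and $x_2(k)=u_n$ if $k=2n+1$; $x_3(k)=-u_{n-1}$ if $k=2n$ and $x_3(k)=0$ if $k=2n+1$; $x_4(k)=0$ if $k=2n$ and $x_4(k)=-u_{n-1}$ if $k=2n+1$.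
   Context: $u_n$ is the Lucas sequence associated with the roots $\epsilon,\bar\epsilon$ of $X^2-TX+1$ (equivalently $u_0=0$, $u_1=1$, $u_{n+2}=Tu_{n+1}-u_n$). -}

module Defs where

open import Data.Nat as ℕ using (ℕ; zero; suc)
open import Data.Integer as ℤ using (ℤ)
open import Data.Rational as ℚ using (ℚ; 0ℚ; 1ℚ; _/_)
open import Data.Product using (Σ; _×_; _,_; ∃)
open import Relation.Binary.PropositionalEquality using (_≡_)

IsIntegerℚ : ℚ → Set
IsIntegerℚ q = ∃ λ (z : ℤ) → q ≡ z / 1

-- The quadratic field L = ℚ(√d): the pair (a , b) stands for a + b√d.

L : Set
L = ℚ × ℚ

module LOps (d : ℚ) where
  infixl 6 _+L_ _-L_
  infixl 7 _*L_

  0L 1L : L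
  0L = 0ℚ , 0ℚ
  1L = 1ℚ , 0ℚ

  ιL : ℚ → L
  ιL q = q , 0ℚ

  _+L_ : L → L → L
  (a , b) +L (c , e) = a ℚ.+ c , b ℚ.+ e

  -L_ : L → L
  -L (a , b) = ℚ.- a , ℚ.- b

  _-L_ : L → L → L
  x -L y = x +L (-L y)

  _*L_ : L → L → L
  (a , b) *L (c , e) = a ℚ.* c ℚ.+ d ℚ.* (b ℚ.* e) , a ℚ.* e ℚ.+ b ℚ.* c

  conjL : L → L
  conjL (a , b) = a , ℚ.- b

  normL : L → ℚ
  normL (a , b) = a ℚ.* a ℚ.- d ℚ.* (b ℚ.* b)

  traceL : L → ℚ
  traceL (a , b) = a ℚ.+ a

  -- algebraic integers of L: characteristic polynomial
  -- X² - Tr(x) X + N(x) has integer coefficients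
  IntegralL : L → Set
  IntegralL x = IsIntegerℚ (traceL x) × IsIntegerℚ (normL x)

  UnitL : L → Set
  UnitL x = IntegralL x × Σ L (λ y → IntegralL y × x *L y ≡ 1L)

  lucas : L → ℕ → L
  lucas T zero = 0L
  lucas T (suc zero) = 1L
  lucas T (suc (suc n)) = T *L lucas T (suc n) -L lucas T n

-- The quartic field K = L(√γ): the pair (p , q) stands for p + q√γ,
-- with p, q ∈ L and γ ∈ L a non-square of L.

K : Set
K = L × L

module KOps (d : ℚ) (γ : L) where
  open LOps d public
  infixl 6 _+K_ _-K_
  infixl 7 _*K_

  0K 1K : K
  0K = 0L , 0L
  1K = 1L , 0L

  ιK : L → K
  ιK x = x , 0L

  ιQK : ℚ → K
  ιQK q = ιK (ιL q)

  _+K_ : K → K → K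
  (p , q) +K (r , s) = p +L r , q +L s

  -K_ : K → K
  -K (p , q) = -L p , -L q

  _-K_ : K → K → K
  x -K y = x +K (-K y)

  _*K_ : K → K → K
  (p , q) *K (r , s) = p *L r +L γ *L (q *L s) , p *L s +L q *L r

  _^K_ : K → ℕ → K
  x ^K zero = 1K
  x ^K suc n = x *K (x ^K n)

  normKL : K → L
  normKL (p , q) = p *L p -L γ *L (q *L q)

  normK : K → ℚ
  normK x = normL (normKL x)

  -- x has degree 4 over ℚ: no nonzero rational polynomial of degree ≤ 3
  -- vanishes at x  (its minimal polynomial over ℚ has degree 4)
  Degree4 : K → Set
  Degree4 x = ∀ (c₀ c₁ c₂ c₃ : ℚ) →
    ιQK c₀ +K ιQK c₁ *K x +K ιQK c₂ *K (x ^K 2) +K ιQK c₃ *K (x ^K 3) ≡ 0K →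
    (c₀ ≡ 0ℚ) × (c₁ ≡ 0ℚ) × (c₂ ≡ 0ℚ) × (c₃ ≡ 0ℚ)

  combo : L → L → L → L → K → K → K → K → K
  combo x₁ x₂ x₃ x₄ w₁ w₂ w₃ w₄ =
    ιK x₁ *K w₁ +K ιK x₂ *K w₂ +K ιK x₃ *K w₃ +K ιK x₄ *K w₄

module Submission where

-- Since η² = ε lies in L, the powers of η are governed by those of ε, and ε
-- is a root of X² − TX + 1 as soon as N(ε) = 1.  In any commutative ring, a
-- root e of X² − tX + 1 satisfies e^{n+1} = U_{n+1} e − U_n for the Lucas
-- sequence U of t; writing β η^{2n} = β e^n and β η^{2n+1} = β e^n η and
-- expanding in the basis gives the stated coefficients (LucasSequences).
-- To apply this, ℚ(√d) and K = ℚ(√d)(√γ) of Defs are shown to be commutative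
-- rings (QuadraticExtension), and N(ε) = 1 is derived (QuadraticField): as d
-- is not a square, L has no zero divisors, so η² ∈ L forces η ∈ L or
-- η ∈ L√γ, whence N(η) = N(ε) > 0; and a unit of positive norm has norm 1.
-- Ring identities are checked by a solver with integer coefficients that
-- works in every commutative ring (IntegerCoefficientSolver).

open import Defs
open import Level using (Level)
open import Algebra.Bundles using (CommutativeRing)
open import Algebra.Structures using (IsCommutativeRing)
import Algebra.Solver.Ring as RingSolver
import Algebra.Solver.Ring.AlmostCommutativeRing as ACR
open import Data.Nat as ℕ using (ℕ; zero; suc; _≤_)
import Data.Nat.Properties as ℕ
open import Data.Integer as ℤ using (ℤ; +_; -[1+_])
import Data.Integer.Properties as ℤ
open import Data.Sign as Sign using (Sign)
open import Data.Maybe using (map)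
open import Data.Product using (_×_; _,_; ∃; proj₁; proj₂)
open import Data.Product.Properties using (≡-dec)
open import Data.Sum using (_⊎_; inj₁; inj₂; [_,_]′)
open import Function using (id)
open import Relation.Nullary using (¬_; yes; no)
open import Relation.Nullary.Decidable using (Dec; dec⇒maybe)
open import Relation.Binary.PropositionalEquality
  using (_≡_; _≢_; cong; cong₂)
import Relation.Binary.PropositionalEquality as ≡

-- The image of 1 is 1# itself,
-- so the constants 0# and 1# are written con (+ 0) and con (+ 1).
module IntegerCoefficientSolver {a ℓ : Level} (R : CommutativeRing a ℓ) where

  open CommutativeRing R
  open import Algebra.Properties.Ring ring
    using (-0#≈0#; -‿involutive; -‿distribˡ-*; -‿distribʳ-*; -‿+-comm)
  open import Algebra.Properties.Semiring.Mult.TCOptimised semiring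
    using (1+×; ×-homo-+; ×1-homo-*) renaming (_×_ to _×′_)
  open import Relation.Binary.Reasoning.Setoid setoid

  ⟦_⟧ℤ : ℤ → Carrier
  ⟦ + n ⟧ℤ = n ×′ 1#
  ⟦ -[1+ n ] ⟧ℤ = - (suc n ×′ 1#)

  private
    signed : Sign → Carrier → Carrier
    signed Sign.+ x = x
    signed Sign.- x = - x

    signed-cong : ∀ s {x y} → x ≈ y → signed s x ≈ signed s y
    signed-cong Sign.+ x≈y = x≈y
    signed-cong Sign.- x≈y = -‿cong x≈y

    1+x-[1+y]≈x-y : ∀ x y → (1# + x) - (1# + y) ≈ x - y
    1+x-[1+y]≈x-y x y = begin
      (1# + x) + - (1# + y)   ≈⟨ +-congˡ (-‿+-comm 1# y) ⟨
      (1# + x) + (- 1# + - y) ≈⟨ +-assoc 1# x _ ⟩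
      1# + (x + (- 1# + - y)) ≈⟨ +-congˡ (+-assoc x (- 1#) (- y)) ⟨
      1# + ((x + - 1#) + - y) ≈⟨ +-congˡ (+-congʳ (+-comm x (- 1#))) ⟩
      1# + ((- 1# + x) + - y) ≈⟨ +-congˡ (+-assoc (- 1#) x (- y)) ⟩
      1# + (- 1# + (x + - y)) ≈⟨ +-assoc 1# (- 1#) _ ⟨
      (1# + - 1#) + (x + - y) ≈⟨ +-congʳ (-‿inverseʳ 1#) ⟩
      0# + (x + - y)          ≈⟨ +-identityˡ _ ⟩
      x - y                   ∎

    -- ⟦_⟧ℤ respects the subtraction of naturals, by which ℤ's addition is defined
    ⊖-homo : ∀ m n → ⟦ m ℤ.⊖ n ⟧ℤ ≈ m ×′ 1# - n ×′ 1#
    ⊖-homo zero zero = sym (trans (+-congˡ -0#≈0#) (+-identityʳ 0#))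
    ⊖-homo zero (suc n) = sym (+-identityˡ _)
    ⊖-homo (suc m) zero = sym (trans (+-congˡ -0#≈0#) (+-identityʳ _))
    ⊖-homo (suc m) (suc n) = begin
      ⟦ suc m ℤ.⊖ suc n ⟧ℤ            ≡⟨ cong ⟦_⟧ℤ (ℤ.[1+m]⊖[1+n]≡m⊖n m n) ⟩
      ⟦ m ℤ.⊖ n ⟧ℤ                    ≈⟨ ⊖-homo m n ⟩
      m ×′ 1# - n ×′ 1#                 ≈⟨ 1+x-[1+y]≈x-y _ _ ⟨
      (1# + m ×′ 1#) - (1# + n ×′ 1#)   ≈⟨ +-cong (1+× m 1#) (-‿cong (1+× n 1#)) ⟨
      suc m ×′ 1# - suc n ×′ 1#         ∎

    +-homo : ∀ i j → ⟦ i ℤ.+ j ⟧ℤ ≈ ⟦ i ⟧ℤ + ⟦ j ⟧ℤ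
    +-homo (+ m) (+ n) = ×-homo-+ 1# m n
    +-homo (+ m) -[1+ n ] = ⊖-homo m (suc n)
    +-homo -[1+ m ] (+ n) = trans (⊖-homo n (suc m)) (+-comm _ _)
    +-homo -[1+ m ] -[1+ n ] = begin
      - (suc (suc (m ℕ.+ n)) ×′ 1#)      ≡⟨ cong (λ k → - (suc k ×′ 1#)) (ℕ.+-suc m n) ⟨
      - ((suc m ℕ.+ suc n) ×′ 1#)        ≈⟨ -‿cong (×-homo-+ 1# (suc m) (suc n)) ⟩
      - (suc m ×′ 1# + suc n ×′ 1#)       ≈⟨ -‿+-comm _ _ ⟨
      - (suc m ×′ 1#) + - (suc n ×′ 1#)   ∎

    -- multiplication in ℤ goes through signs and absolute values
    ◃-homo : ∀ s n → ⟦ s ℤ.◃ n ⟧ℤ ≈ signed s (n ×′ 1#)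
    ◃-homo Sign.+ zero = refl
    ◃-homo Sign.- zero = sym -0#≈0#
    ◃-homo Sign.+ (suc n) = refl
    ◃-homo Sign.- (suc n) = refl

    signed-abs : ∀ i → ⟦ i ⟧ℤ ≡ signed (ℤ.sign i) (ℤ.∣ i ∣ ×′ 1#)
    signed-abs (+ n) = ≡.refl
    signed-abs -[1+ n ] = ≡.refl

    signed-* : ∀ s t x y → signed (s Sign.* t) (x * y) ≈ signed s x * signed t y
    signed-* Sign.+ Sign.+ x y = refl
    signed-* Sign.+ Sign.- x y = -‿distribʳ-* x y
    signed-* Sign.- Sign.+ x y = -‿distribˡ-* x y
    signed-* Sign.- Sign.- x y = begin
      x * y         ≈⟨ -‿involutive _ ⟨
      - - (x * y)   ≈⟨ -‿cong (-‿distribʳ-* x y) ⟩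
      - (x * - y)   ≈⟨ -‿distribˡ-* x (- y) ⟩
      - x * - y     ∎

    *-homo : ∀ i j → ⟦ i ℤ.* j ⟧ℤ ≈ ⟦ i ⟧ℤ * ⟦ j ⟧ℤ
    *-homo i j = begin
      ⟦ s ℤ.◃ ∣i∣ ℕ.* ∣j∣ ⟧ℤ               ≈⟨ ◃-homo s (∣i∣ ℕ.* ∣j∣) ⟩
      signed s ((∣i∣ ℕ.* ∣j∣) ×′ 1#)         ≈⟨ signed-cong s (×1-homo-* ∣i∣ ∣j∣) ⟩
      signed s ((∣i∣ ×′ 1#) * (∣j∣ ×′ 1#))    ≈⟨ signed-* (ℤ.sign i) (ℤ.sign j) _ _ ⟩
      signed (ℤ.sign i) (∣i∣ ×′ 1#) * signed (ℤ.sign j) (∣j∣ ×′ 1#)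
                                            ≡⟨ cong₂ _*_ (signed-abs i) (signed-abs j) ⟨
      ⟦ i ⟧ℤ * ⟦ j ⟧ℤ                       ∎
      where
      s = ℤ.sign i Sign.* ℤ.sign j
      ∣i∣ = ℤ.∣ i ∣
      ∣j∣ = ℤ.∣ j ∣

    neg-homo : ∀ i → ⟦ ℤ.- i ⟧ℤ ≈ - ⟦ i ⟧ℤ
    neg-homo (+ zero) = sym -0#≈0#
    neg-homo (+ suc n) = refl
    neg-homo -[1+ n ] = sym (-‿involutive _)

    ring-R : ACR.AlmostCommutativeRing a ℓ
    ring-R = ACR.fromCommutativeRing R

    morphism : ℤ.+-*-rawRing ACR.-Raw-AlmostCommutative⟶ ring-R
    morphism = record
      { ⟦_⟧ = ⟦_⟧ℤ ; +-homo = +-homo ; *-homo = *-homo ; -‿homo = neg-homo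
      ; 0-homo = refl ; 1-homo = refl }

  open RingSolver ℤ.+-*-rawRing ring-R morphism
    (λ i j → map (λ i≡j → reflexive (cong ⟦_⟧ℤ i≡j)) (dec⇒maybe (i ℤ.≟ j)))
    public using (solve; _:+_; _:*_; _:-_; :-_; _:=_; con)

module Invertibility {a ℓ : Level} (R : CommutativeRing a ℓ) where

  open CommutativeRing R
  open import Relation.Binary.Reasoning.Setoid setoid

  Invertible : Carrier → Set (a Level.⊔ ℓ)
  Invertible x = ∃ λ y → y * x ≈ 1#

  -- R is a domain (apart from 1 ≠ 0)
  NoZeroDivisors : Set (a Level.⊔ ℓ)
  NoZeroDivisors = ∀ x y → x * y ≈ 0# → x ≈ 0# ⊎ y ≈ 0#

  invertible-cancel : ∀ {x z} → Invertible x → x * z ≈ 0# → z ≈ 0#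
  invertible-cancel {x} {z} (y , y*x≈1) x*z≈0 = begin
    z             ≈⟨ *-identityˡ z ⟨
    1# * z        ≈⟨ *-congʳ y*x≈1 ⟨
    (y * x) * z   ≈⟨ *-assoc y x z ⟩
    y * (x * z)   ≈⟨ *-congˡ x*z≈0 ⟩
    y * 0#        ≈⟨ zeroʳ y ⟩
    0#            ∎

  field⇒noZeroDivisors : (∀ x → Dec (x ≈ 0#)) → (∀ x → ¬ x ≈ 0# → Invertible x) →
                         NoZeroDivisors
  field⇒noZeroDivisors zero? inverse x y x*y≈0 with zero? x
  ... | yes x≈0 = inj₁ x≈0
  ... | no x≉0 = inj₂ (invertible-cancel (inverse x x≉0) x*y≈0)

  double-cancel : Invertible (1# + 1#) → ∀ {x} → x + x ≈ 0# → x ≈ 0#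
  double-cancel two⁻¹ {x} x+x≈0 = invertible-cancel two⁻¹ (begin
    (1# + 1#) * x   ≈⟨ distribʳ x 1# 1# ⟩
    1# * x + 1# * x ≈⟨ +-cong (*-identityˡ x) (*-identityˡ x) ⟩
    x + x           ≈⟨ x+x≈0 ⟩
    0#              ∎)

-- The quadratic extension R[√c] of a commutative ring R whose equality is
-- propositional: pairs (x , y) standing for x + y√c.  Its operations are
-- exactly those of Defs, so ℚ(√d) and ℚ(√d)(√γ) become commutative rings.
module QuadraticExtension {a ℓ : Level} (R : CommutativeRing a ℓ)
  (≈⇒≡ : ∀ {x y} → CommutativeRing._≈_ R x y → x ≡ y)
  (c : CommutativeRing.Carrier R) where

  open CommutativeRing R hiding (isCommutativeRing)
  open IntegerCoefficientSolver R
  open Invertibility R using (Invertible; NoZeroDivisors; double-cancel)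

  Ext : Set a
  Ext = Carrier × Carrier

  infixl 6 _⊕_
  infixl 7 _⊗_
  infix 8 ⊖_

  _⊕_ _⊗_ : Ext → Ext → Ext
  (x , y) ⊕ (x′ , y′) = x + x′ , y + y′
  (x , y) ⊗ (x′ , y′) = x * x′ + c * (y * y′) , x * y′ + y * x′

  ⊖_ : Ext → Ext
  ⊖ (x , y) = - x , - y

  ι : Carrier → Ext
  ι x = x , 0#

  conj : Ext → Ext
  conj (x , y) = x , - y

  norm : Ext → Carrier
  norm (x , y) = x * x - c * (y * y)

  private
    pair : ∀ {x y x′ y′} → x ≈ x′ → y ≈ y′ → (x , y) ≡ (x′ , y′)
    pair p q = cong₂ _,_ (≈⇒≡ p) (≈⇒≡ q)

    -- componentwise identities; c is a variable k for the solver
    *-assoc₁ : ∀ k x y x′ y′ x″ y″ →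
      (x * x′ + k * (y * y′)) * x″ + k * ((x * y′ + y * x′) * y″)
        ≈ x * (x′ * x″ + k * (y′ * y″)) + k * (y * (x′ * y″ + y′ * x″))
    *-assoc₁ = solve 7 (λ k x y x′ y′ x″ y″ →
      (x :* x′ :+ k :* (y :* y′)) :* x″ :+ k :* ((x :* y′ :+ y :* x′) :* y″)
        := x :* (x′ :* x″ :+ k :* (y′ :* y″)) :+ k :* (y :* (x′ :* y″ :+ y′ :* x″))) refl
    *-assoc₂ : ∀ k x y x′ y′ x″ y″ →
      (x * x′ + k * (y * y′)) * y″ + (x * y′ + y * x′) * x″
        ≈ x * (x′ * y″ + y′ * x″) + y * (x′ * x″ + k * (y′ * y″))
    *-assoc₂ = solve 7 (λ k x y x′ y′ x″ y″ →
      (x :* x′ :+ k :* (y :* y′)) :* y″ :+ (x :* y′ :+ y :* x′) :* x″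
        := x :* (x′ :* y″ :+ y′ :* x″) :+ y :* (x′ :* x″ :+ k :* (y′ :* y″))) refl
    *-identityˡ₁ : ∀ k x y → 1# * x + k * (0# * y) ≈ x
    *-identityˡ₁ = solve 3 (λ k x y → con (+ 1) :* x :+ k :* (con (+ 0) :* y) := x) refl
    *-identityˡ₂ : ∀ x y → 1# * y + 0# * x ≈ y
    *-identityˡ₂ = solve 2 (λ x y → con (+ 1) :* y :+ con (+ 0) :* x := y) refl
    *-identityʳ₁ : ∀ k x y → x * 1# + k * (y * 0#) ≈ x
    *-identityʳ₁ = solve 3 (λ k x y → x :* con (+ 1) :+ k :* (y :* con (+ 0)) := x) refl
    *-identityʳ₂ : ∀ x y → x * 0# + y * 1# ≈ y
    *-identityʳ₂ = solve 2 (λ x y → x :* con (+ 0) :+ y :* con (+ 1) := y) refl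
    distribˡ₁ : ∀ k x y x′ y′ x″ y″ →
      x * (x′ + x″) + k * (y * (y′ + y″)) ≈ (x * x′ + k * (y * y′)) + (x * x″ + k * (y * y″))
    distribˡ₁ = solve 7 (λ k x y x′ y′ x″ y″ →
      x :* (x′ :+ x″) :+ k :* (y :* (y′ :+ y″))
        := (x :* x′ :+ k :* (y :* y′)) :+ (x :* x″ :+ k :* (y :* y″))) refl
    distribˡ₂ : ∀ x y x′ y′ x″ y″ →
      x * (y′ + y″) + y * (x′ + x″) ≈ (x * y′ + y * x′) + (x * y″ + y * x″)
    distribˡ₂ = solve 6 (λ x y x′ y′ x″ y″ →
      x :* (y′ :+ y″) :+ y :* (x′ :+ x″) := (x :* y′ :+ y :* x′) :+ (x :* y″ :+ y :* x″)) refl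
    distribʳ₁ : ∀ k x y x′ y′ x″ y″ →
      (x′ + x″) * x + k * ((y′ + y″) * y) ≈ (x′ * x + k * (y′ * y)) + (x″ * x + k * (y″ * y))
    distribʳ₁ = solve 7 (λ k x y x′ y′ x″ y″ →
      (x′ :+ x″) :* x :+ k :* ((y′ :+ y″) :* y)
        := (x′ :* x :+ k :* (y′ :* y)) :+ (x″ :* x :+ k :* (y″ :* y))) refl
    distribʳ₂ : ∀ x y x′ y′ x″ y″ →
      (x′ + x″) * y + (y′ + y″) * x ≈ (x′ * y + y′ * x) + (x″ * y + y″ * x)
    distribʳ₂ = solve 6 (λ x y x′ y′ x″ y″ →
      (x′ :+ x″) :* y :+ (y′ :+ y″) :* x := (x′ :* y :+ y′ :* x) :+ (x″ :* y :+ y″ :* x)) refl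
    *-comm₁ : ∀ k x y x′ y′ → x * x′ + k * (y * y′) ≈ x′ * x + k * (y′ * y)
    *-comm₁ = solve 5 (λ k x y x′ y′ → x :* x′ :+ k :* (y :* y′) := x′ :* x :+ k :* (y′ :* y)) refl
    *-comm₂ : ∀ x y x′ y′ → x * y′ + y * x′ ≈ x′ * y + y′ * x
    *-comm₂ = solve 4 (λ x y x′ y′ → x :* y′ :+ y :* x′ := x′ :* y :+ y′ :* x) refl

  isCommutativeRing : IsCommutativeRing _≡_ _⊕_ _⊗_ ⊖_ (ι 0#) (ι 1#)
  isCommutativeRing = record
    { isRing = record
      { +-isAbelianGroup = record
        { isGroup = record
          { isMonoid = record
            { isSemigroup = record
              { isMagma = record { isEquivalence = ≡.isEquivalence ; ∙-cong = cong₂ _⊕_ }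
              ; assoc = λ { (x , y) (x′ , y′) (x″ , y″) → pair (+-assoc x x′ x″) (+-assoc y y′ y″) } }
            ; identity = (λ { (x , y) → pair (+-identityˡ x) (+-identityˡ y) })
                       , (λ { (x , y) → pair (+-identityʳ x) (+-identityʳ y) }) }
          ; inverse = (λ { (x , y) → pair (-‿inverseˡ x) (-‿inverseˡ y) })
                    , (λ { (x , y) → pair (-‿inverseʳ x) (-‿inverseʳ y) })
          ; ⁻¹-cong = cong ⊖_ }
        ; comm = λ { (x , y) (x′ , y′) → pair (+-comm x x′) (+-comm y y′) } }
      ; *-cong = cong₂ _⊗_
      ; *-assoc = λ { (x , y) (x′ , y′) (x″ , y″) →
          pair (*-assoc₁ c x y x′ y′ x″ y″) (*-assoc₂ c x y x′ y′ x″ y″) }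
      ; *-identity = (λ { (x , y) → pair (*-identityˡ₁ c x y) (*-identityˡ₂ x y) })
                   , (λ { (x , y) → pair (*-identityʳ₁ c x y) (*-identityʳ₂ x y) })
      ; distrib = (λ { (x , y) (x′ , y′) (x″ , y″) →
                       pair (distribˡ₁ c x y x′ y′ x″ y″) (distribˡ₂ x y x′ y′ x″ y″) })
                , (λ { (x , y) (x′ , y′) (x″ , y″) →
                       pair (distribʳ₁ c x y x′ y′ x″ y″) (distribʳ₂ x y x′ y′ x″ y″) }) }
    ; *-comm = λ { (x , y) (x′ , y′) → pair (*-comm₁ c x y x′ y′) (*-comm₂ x y x′ y′) } }

  commutativeRing : CommutativeRing a a
  commutativeRing = record { isCommutativeRing = isCommutativeRing }

  ι-* : ∀ x y → ι (x * y) ≡ ι x ⊗ ι y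
  ι-* x y = pair (solve 3 (λ k x y → x :* y := x :* y :+ k :* (con (+ 0) :* con (+ 0))) refl c x y)
                 (solve 2 (λ x y → con (+ 0) := x :* con (+ 0) :+ con (+ 0) :* y) refl x y)

  conj-product : ∀ z → z ⊗ conj z ≡ ι (norm z)
  conj-product (x , y) =
    pair (solve 3 (λ k x y → x :* x :+ k :* (y :* (:- y)) := x :* x :- k :* (y :* y)) refl c x y)
         (solve 2 (λ x y → x :* (:- y) :+ y :* x := con (+ 0)) refl x y)

  characteristic-equation : ∀ z → z ⊗ z ≡ (z ⊕ conj z) ⊗ z ⊕ ⊖ ι (norm z)
  characteristic-equation (x , y) = pair
    (solve 3 (λ k x y → x :* x :+ k :* (y :* y)
      := (x :+ x) :* x :+ k :* ((y :+ :- y) :* y) :+ :- (x :* x :- k :* (y :* y))) refl c x y)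
    (solve 2 (λ x y → x :* y :+ y :* x
      := (x :+ x) :* y :+ (y :+ :- y) :* x :+ :- con (+ 0)) refl x y)

  norm-* : ∀ z w → norm (z ⊗ w) ≈ norm z * norm w
  norm-* (x , y) (x′ , y′) = solve 5 (λ k x y x′ y′ →
    (x :* x′ :+ k :* (y :* y′)) :* (x :* x′ :+ k :* (y :* y′))
      :- k :* ((x :* y′ :+ y :* x′) :* (x :* y′ :+ y :* x′))
      := (x :* x :- k :* (y :* y)) :* (x′ :* x′ :- k :* (y′ :* y′))) refl c x y x′ y′

  norm-⊖ : ∀ z → norm (⊖ z) ≈ norm z
  norm-⊖ (x , y) = solve 3 (λ k x y →
    (:- x) :* (:- x) :- k :* ((:- y) :* (:- y)) := x :* x :- k :* (y :* y)) refl c x y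

  norm-1 : norm (ι 1#) ≈ 1#
  norm-1 = solve 1 (λ k → con (+ 1) :* con (+ 1) :- k :* (con (+ 0) :* con (+ 0)) := con (+ 1)) refl c

  -- If z² lies in R, then z ∈ R or z ∈ R√c (R a domain with 2 invertible),
  -- so its norm is ± z².
  norm-of-square-root : NoZeroDivisors → Invertible (1# + 1#) →
                        ∀ z a → z ⊗ z ≡ ι a → norm z ≡ a ⊎ norm z ≡ - a
  norm-of-square-root noZeroDivisors two⁻¹ (x , y) a z²≡a
    with noZeroDivisors x y (double-cancel two⁻¹ xy+xy≈0)
    where
    xy+xy≈0 : x * y + x * y ≈ 0#
    xy+xy≈0 = trans (+-congˡ (*-comm x y)) (reflexive (cong proj₂ z²≡a))
  ... | inj₁ x≈0 rewrite ≈⇒≡ x≈0 = inj₂ (begin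
    0# * 0# - c * (y * y)     ≡⟨ ≈⇒≡ (solve 2 (λ k y → con (+ 0) :* con (+ 0) :- k :* (y :* y)
                                    := :- (con (+ 0) :* con (+ 0) :+ k :* (y :* y))) refl c y) ⟩
    - (0# * 0# + c * (y * y)) ≡⟨ cong -_ (cong proj₁ z²≡a) ⟩
    - a                       ∎)
    where open ≡.≡-Reasoning
  ... | inj₂ y≈0 rewrite ≈⇒≡ y≈0 = inj₁ (begin
    x * x - c * (0# * 0#)     ≡⟨ ≈⇒≡ (solve 2 (λ k x → x :* x :- k :* (con (+ 0) :* con (+ 0))
                                    := x :* x :+ k :* (con (+ 0) :* con (+ 0))) refl c x) ⟩
    x * x + c * (0# * 0#)     ≡⟨ cong proj₁ z²≡a ⟩
    a                         ∎)
    where open ≡.≡-Reasoning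

module LucasSequences {a ℓ : Level} (R : CommutativeRing a ℓ) where

  open CommutativeRing R
  open IntegerCoefficientSolver R
  open import Algebra.Properties.Semiring.Exp semiring using (_^_; ^-homo-*; ^-assocʳ)
  open import Relation.Binary.Reasoning.Setoid setoid

  record IsLucasSequence (t : Carrier) (U : ℕ → Carrier) : Set ℓ where
    field
      initial₀   : U 0 ≈ 0#
      initial₁   : U 1 ≈ 1#
      recurrence : ∀ n → U (suc (suc n)) ≈ t * U (suc n) - U n

  module _ {t e : Carrier} {U : ℕ → Carrier} (lucas : IsLucasSequence t U)
           (root : e * e ≈ t * e - 1#) where

    open IsLucasSequence lucas

    lucas-powers : ∀ n → e ^ suc n ≈ U (suc n) * e - U n
    lucas-powers zero = begin
      e * 1#          ≈⟨ solve 1 (λ e → e :* con (+ 1) := con (+ 1) :* e :- con (+ 0)) refl e ⟩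
      1# * e - 0#     ≈⟨ +-cong (*-congʳ initial₁) (-‿cong initial₀) ⟨
      U 1 * e - U 0   ∎
    lucas-powers (suc n) = begin
      e * e ^ suc n                        ≈⟨ *-congˡ (lucas-powers n) ⟩
      e * (U (suc n) * e - U n)            ≈⟨ solve 3 (λ e u v → e :* (u :* e :- v) := u :* (e :* e) :- v :* e) refl e _ _ ⟩
      U (suc n) * (e * e) - U n * e        ≈⟨ +-congʳ (*-congˡ root) ⟩
      U (suc n) * (t * e - 1#) - U n * e   ≈⟨ solve 4 (λ e t u v → u :* (t :* e :- con (+ 1)) :- v :* e
                                                := (t :* u :- v) :* e :- u) refl e t _ _ ⟩
      (t * U (suc n) - U n) * e - U (suc n) ≈⟨ +-congʳ (*-congʳ (recurrence n)) ⟨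
      U (suc (suc n)) * e - U (suc n)      ∎

  module BasisDecomposition {t η : Carrier} {U : ℕ → Carrier} (lucas : IsLucasSequence t U)
           (root : η ^ 2 * η ^ 2 ≈ t * η ^ 2 - 1#) (β : Carrier) where

    open IsLucasSequence lucas

    w₁ w₂ w₃ w₄ : Carrier
    w₁ = β * η ^ 2
    w₂ = β * η ^ 3 - (t + 1#) * w₁
    w₃ = β
    w₄ = β * η - w₁

    private
      e = η ^ 2

      even-power : ∀ m → η ^ (2 ℕ.* suc m) ≈ U (suc m) * e - U m
      even-power m = trans (sym (^-assocʳ η 2 (suc m))) (lucas-powers lucas root m)

    even-decomposition : ∀ m →
      β * η ^ (2 ℕ.* suc m) ≈ U (suc m) * w₁ + 0# * w₂ + (- U m) * w₃ + 0# * w₄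
    even-decomposition m = begin
      β * η ^ (2 ℕ.* suc m)       ≈⟨ *-congˡ (even-power m) ⟩
      β * (U (suc m) * e - U m)   ≈⟨ solve 6 (λ β e u v w₂ w₄ → β :* (u :* e :- v)
                                       := u :* (β :* e) :+ con (+ 0) :* w₂ :+ (:- v) :* β :+ con (+ 0) :* w₄)
                                       refl β e _ _ w₂ w₄ ⟩
      U (suc m) * w₁ + 0# * w₂ + (- U m) * w₃ + 0# * w₄ ∎

    odd-decomposition : ∀ m →
      β * η ^ (2 ℕ.* suc m ℕ.+ 1)
        ≈ (U (suc m ℕ.+ 1) + U (suc m)) * w₁ + U (suc m) * w₂ + 0# * w₃ + (- U m) * w₄
    odd-decomposition m = begin
      β * η ^ (2 ℕ.* suc m ℕ.+ 1)                ≈⟨ *-congˡ (^-homo-* η (2 ℕ.* suc m) 1) ⟩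
      β * (η ^ (2 ℕ.* suc m) * η ^ 1)            ≈⟨ *-congˡ (*-cong (even-power m) (*-identityʳ η)) ⟩
      β * ((U (suc m) * e - U m) * η)            ≈⟨ solve 6 (λ β η e t u v →
          β :* ((u :* e :- v) :* η)
            := ((t :* u :- v) :+ u) :* (β :* e) :+ u :* (β :* (η :* e) :- (t :+ con (+ 1)) :* (β :* e))
               :+ con (+ 0) :* β :+ (:- v) :* (β :* η :- β :* e)) refl β η e t _ _ ⟩
      ((t * U (suc m) - U m) + U (suc m)) * w₁ + U (suc m) * w₂ + 0# * w₃ + (- U m) * w₄
        ≈⟨ +-congʳ (+-congʳ (+-congʳ (*-congʳ (+-congʳ next-term)))) ⟩
      (U (suc m ℕ.+ 1) + U (suc m)) * w₁ + U (suc m) * w₂ + 0# * w₃ + (- U m) * w₄ ∎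
      where
      next-term : t * U (suc m) - U m ≈ U (suc m ℕ.+ 1)
      next-term = trans (sym (recurrence m)) (reflexive (cong (λ k → U (suc k)) (ℕ.+-comm 1 m)))

open import Data.Rational as ℚ using (ℚ; 0ℚ; 1ℚ; _<_; _*_)
import Data.Rational.Properties as ℚ
import Data.Rational.Unnormalised as ℚᵘ
import Data.Nat.Coprimality as Coprimality

-- the rationals as a commutative ring, with _≡_ as its equality
ℚ-ring : CommutativeRing Level.zero Level.zero
ℚ-ring = ℚ.+-*-commutativeRing

ℚ-inverse : ∀ p → p ≢ 0ℚ → Invertibility.Invertible ℚ-ring p
ℚ-inverse p p≢0 = ℚ.1/ p , ℚ.*-inverseˡ p
  where instance _ = ℚ.≢-nonZero p≢0

ℚ-noZeroDivisors : Invertibility.NoZeroDivisors ℚ-ring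
ℚ-noZeroDivisors = Invertibility.field⇒noZeroDivisors ℚ-ring (ℚ._≟ 0ℚ) ℚ-inverse

integer : ℤ → ℚ
integer i = ℚ.mkℚ i 0 (Coprimality.sym (Coprimality.1-coprimeTo ℤ.∣ i ∣))

integer-fraction : ∀ i → i ℚ./ 1 ≡ integer i
integer-fraction (+ n) = ℚ.normalize-coprime (Coprimality.sym (Coprimality.1-coprimeTo n))
integer-fraction -[1+ n ] =
  cong ℚ.-_ (ℚ.normalize-coprime (Coprimality.sym (Coprimality.1-coprimeTo (suc n))))

positive-unit : ∀ i j → ℤ.0ℤ ℤ.< i → i ℤ.* j ≡ ℤ.1ℤ → i ≡ ℤ.1ℤ
positive-unit (+ n) j _ ij≡1
  with ℕ.m*n≡1⇒m≡1 n ℤ.∣ j ∣ (≡.trans (≡.sym (ℤ.abs-* (+ n) j)) (cong ℤ.∣_∣ ij≡1))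
... | ≡.refl = ≡.refl

positive-integer-unit : ∀ i j → 0ℚ < i ℚ./ 1 → (i ℚ./ 1) * (j ℚ./ 1) ≡ 1ℚ → i ℚ./ 1 ≡ 1ℚ
positive-integer-unit i j 0<i ij≡1 rewrite integer-fraction i | integer-fraction j
  with positive-unit i j 0<ℤi ℤij≡1
  where
  0<ℤi : ℤ.0ℤ ℤ.< i
  0<ℤi = ≡.subst (ℤ.0ℤ ℤ.<_) (ℤ.*-identityʳ i) (ℚ.drop-*<* 0<i)
  ℤij≡1 : i ℤ.* j ≡ ℤ.1ℤ
  ℤij≡1 with ≡.subst (λ r → ℚ.toℚᵘ r ℚᵘ.≃ ℚᵘ.mkℚᵘ (i ℤ.* j) 0) ij≡1 (ℚ.toℚᵘ-homo-* (integer i) (integer j))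
  ... | ℚᵘ.*≡* 1≡ij = ≡.trans (≡.sym (ℤ.*-identityʳ (i ℤ.* j))) (≡.sym 1≡ij)
... | ≡.refl = ≡.refl

module QuadraticField (d : ℚ) where

  open LOps d
  open QuadraticExtension ℚ-ring id d
    using (ι-*; conj-product; characteristic-equation; norm-*; norm-⊖; norm-1)
    renaming (commutativeRing to L-ring)
  open CommutativeRing L-ring using (*-assoc; *-comm)
  open Invertibility L-ring using (Invertible; NoZeroDivisors; field⇒noZeroDivisors)
  open IntegerCoefficientSolver ℚ-ring using (solve; _:+_; _:*_; _:-_; _:=_; con)
  open ≡.≡-Reasoning

  norm≢0 : (∀ q → q * q ≢ d) → ∀ x → x ≢ 0L → normL x ≢ 0ℚ
  norm≢0 nonsquare (a , b) x≢0 N≡0 with b ℚ.≟ 0ℚ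
  ... | yes ≡.refl = x≢0 (cong (_, 0ℚ) a≡0)
    where
    a*a≡0 : a * a ≡ 0ℚ
    a*a≡0 = ≡.trans (solve 2 (λ d a → a :* a := a :* a :- d :* (con (+ 0) :* con (+ 0))) ≡.refl d a) N≡0
    a≡0 : a ≡ 0ℚ
    a≡0 = [ id , id ]′ (ℚ-noZeroDivisors a a a*a≡0)
  ... | no b≢0 = nonsquare (a * i) (begin
    (a * i) * (a * i)
      ≡⟨ solve 4 (λ d a b i → (a :* i) :* (a :* i)
           := (a :* a :- d :* (b :* b)) :* (i :* i) :+ d :* ((b :* i) :* (b :* i))) ≡.refl d a b i ⟩
    (a * a ℚ.- d * (b * b)) * (i * i) ℚ.+ d * ((b * i) * (b * i))
      ≡⟨ cong₂ (λ n bi → n * (i * i) ℚ.+ d * (bi * bi)) N≡0 (ℚ.*-inverseʳ b) ⟩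
    0ℚ * (i * i) ℚ.+ d * (1ℚ * 1ℚ)
      ≡⟨ solve 2 (λ d j → con (+ 0) :* j :+ d :* (con (+ 1) :* con (+ 1)) := d) ≡.refl d (i * i) ⟩
    d ∎)
    where
    instance _ = ℚ.≢-nonZero b≢0
    i = ℚ.1/ b

  -- x⁻¹ = x̄ / N(x)
  inverse : (∀ q → q * q ≢ d) → ∀ x → x ≢ 0L → Invertible x
  inverse nonsquare x x≢0 = ιL (ℚ.1/ N) *L conjL x , (begin
    (ιL (ℚ.1/ N) *L conjL x) *L x   ≡⟨ *-assoc (ιL (ℚ.1/ N)) (conjL x) x ⟩
    ιL (ℚ.1/ N) *L (conjL x *L x)   ≡⟨ cong (ιL (ℚ.1/ N) *L_) (≡.trans (*-comm (conjL x) x) (conj-product x)) ⟩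
    ιL (ℚ.1/ N) *L ιL N             ≡⟨ ι-* (ℚ.1/ N) N ⟨
    ιL (ℚ.1/ N * N)                 ≡⟨ cong ιL (ℚ.*-inverseˡ N) ⟩
    1L                              ∎)
    where
    N = normL x
    instance _ = ℚ.≢-nonZero (norm≢0 nonsquare x x≢0)

  noZeroDivisors : (∀ q → q * q ≢ d) → NoZeroDivisors
  noZeroDivisors nonsquare =
    field⇒noZeroDivisors (λ x → ≡-dec ℚ._≟_ ℚ._≟_ x 0L) (inverse nonsquare)

  two-invertible : Invertible (1L +L 1L)
  two-invertible = ιL ℚ.½ , ≡.sym (ι-* ℚ.½ (1ℚ ℚ.+ 1ℚ))

  unit-norm : ∀ ε → UnitL ε → 0ℚ < normL ε → normL ε ≡ 1ℚ
  unit-norm ε ((_ , (i , Nε≡i)) , (y , ((_ , (j , Ny≡j)) , εy≡1))) 0<Nε =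
    ≡.trans Nε≡i (positive-integer-unit i j (≡.subst (0ℚ <_) Nε≡i 0<Nε)
      (≡.subst₂ (λ n m → n * m ≡ 1ℚ) Nε≡i Ny≡j (begin
        normL ε * normL y   ≡⟨ norm-* ε y ⟨
        normL (ε *L y)      ≡⟨ cong normL εy≡1 ⟩
        normL 1L            ≡⟨ norm-1 ⟩
        1ℚ                  ∎)))

  norm-1-root : ∀ ε → normL ε ≡ 1ℚ → ε *L ε ≡ (ε +L conjL ε) *L ε -L 1L
  norm-1-root ε Nε≡1 = ≡.trans (characteristic-equation ε) (cong (λ n → (ε +L conjL ε) *L ε -L ιL n) Nε≡1)

  norm-of-square : (∀ q → q * q ≢ d) → ∀ γ η ε →
                   KOps._*K_ d γ η η ≡ KOps.ιK d γ ε → KOps.normK d γ η ≡ normL ε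
  norm-of-square nonsquare γ η ε η²≡ε =
    [ cong normL , (λ N≡-ε → ≡.trans (cong normL N≡-ε) (norm-⊖ ε)) ]′
      (K.norm-of-square-root (noZeroDivisors nonsquare) two-invertible η ε η²≡ε)
    where module K = QuadraticExtension L-ring id γ

module PowersOfUnit (d : ℚ) (γ : L) (η : K) (ε : L) (β : K) where

  open KOps d γ
  open QuadraticField d using (norm-1-root)
  module Kext = QuadraticExtension (QuadraticExtension.commutativeRing ℚ-ring id d) id γ
  open LucasSequences Kext.commutativeRing
  open import Algebra.Properties.Semiring.Exp (CommutativeRing.semiring Kext.commutativeRing)
    using (_^_)
  open ≡.≡-Reasoning

  T : L
  T = ε +L conjL ε

  powers-agree : ∀ n → η ^K n ≡ η ^ n
  powers-agree zero = ≡.refl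
  powers-agree (suc n) = cong (η *K_) (powers-agree n)

  lucas-K : IsLucasSequence (ιK T) (λ n → ιK (lucas T n))
  lucas-K = record
    { initial₀ = ≡.refl
    ; initial₁ = ≡.refl
    ; recurrence = λ n → cong (_+K ιK (-L lucas T n)) (Kext.ι-* T (lucas T (suc n)))
    }

  combination : K → K → L → L → L → L → K
  combination p₂ p₃ x₁ x₂ x₃ x₄ =
    combo x₁ x₂ x₃ x₄ (β *K p₂) (β *K p₃ -K ιK (T +L 1L) *K (β *K p₂)) β (β *K η -K β *K p₂)

  in-powers-of-K : ∀ x₁ x₂ x₃ x₄ →
    combination (η ^ 2) (η ^ 3) x₁ x₂ x₃ x₄ ≡ combination (η ^K 2) (η ^K 3) x₁ x₂ x₃ x₄
  in-powers-of-K x₁ x₂ x₃ x₄ =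
    cong₂ (λ p₂ p₃ → combination p₂ p₃ x₁ x₂ x₃ x₄) (≡.sym (powers-agree 2)) (≡.sym (powers-agree 3))

  module _ (η²≡ε : η *K η ≡ ιK ε) (Nε≡1 : normL ε ≡ 1ℚ) where

    root : η ^ 2 *K η ^ 2 ≡ ιK T *K η ^ 2 -K 1K
    root = ≡.subst (λ p → p *K p ≡ ιK T *K p -K 1K) (≡.sym η²≡ε′) (begin
      ιK ε *K ιK ε         ≡⟨ Kext.ι-* ε ε ⟨
      ιK (ε *L ε)          ≡⟨ cong ιK (norm-1-root ε Nε≡1) ⟩
      ιK (T *L ε -L 1L)    ≡⟨ cong (_-K 1K) (Kext.ι-* T ε) ⟩
      ιK T *K ιK ε -K 1K   ∎)
      where
      η²≡ε′ : η ^ 2 ≡ ιK ε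
      η²≡ε′ = ≡.trans (cong (η *K_) (CommutativeRing.*-identityʳ Kext.commutativeRing η)) η²≡ε

    open BasisDecomposition {η = η} lucas-K root β

    even-powers : (n : ℕ) → 1 ≤ n → β *K (η ^K (2 ℕ.* n))
      ≡ combination (η ^K 2) (η ^K 3) (lucas T n) 0L (-L lucas T (n ℕ.∸ 1)) 0L
    even-powers (suc m) _ = begin
      β *K (η ^K (2 ℕ.* suc m)) ≡⟨ cong (β *K_) (powers-agree (2 ℕ.* suc m)) ⟩
      β *K (η ^ (2 ℕ.* suc m))  ≡⟨ even-decomposition m ⟩
      combination (η ^ 2) (η ^ 3) (lucas T (suc m)) 0L (-L lucas T m) 0L
        ≡⟨ in-powers-of-K (lucas T (suc m)) 0L (-L lucas T m) 0L ⟩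
      combination (η ^K 2) (η ^K 3) (lucas T (suc m)) 0L (-L lucas T m) 0L ∎

    odd-powers : (n : ℕ) → 1 ≤ n → β *K (η ^K (2 ℕ.* n ℕ.+ 1))
      ≡ combination (η ^K 2) (η ^K 3) (lucas T (n ℕ.+ 1) +L lucas T n) (lucas T n) 0L
          (-L lucas T (n ℕ.∸ 1))
    odd-powers (suc m) _ = begin
      β *K (η ^K (2 ℕ.* suc m ℕ.+ 1)) ≡⟨ cong (β *K_) (powers-agree (2 ℕ.* suc m ℕ.+ 1)) ⟩
      β *K (η ^ (2 ℕ.* suc m ℕ.+ 1))  ≡⟨ odd-decomposition m ⟩
      combination (η ^ 2) (η ^ 3) x₁ (lucas T (suc m)) 0L (-L lucas T m)
        ≡⟨ in-powers-of-K x₁ (lucas T (suc m)) 0L (-L lucas T m) ⟩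
      combination (η ^K 2) (η ^K 3) x₁ (lucas T (suc m)) 0L (-L lucas T m) ∎
      where x₁ = lucas T (suc m ℕ.+ 1) +L lucas T (suc m)

corollary2 : (d : ℚ) → 1ℚ < d → (∀ (q : ℚ) → q * q ≢ d) →
    (γ : L) → (∀ (z : L) → LOps._*L_ d z z ≢ γ) →
    (η : K) → (ε : L) →
    let open KOps d γ in
    Degree4 η → 0ℚ < normK η → η *K η ≡ ιK ε → UnitL ε →
    (β : K) → β ≢ 0K →
    let T = ε +L conjL ε
        u = lucas T
        α = λ (k : ℕ) → β *K (η ^K k)
        w₁ = β *K (η ^K 2)
        w₂ = β *K (η ^K 3) -K ιK (T +L 1L) *K (β *K (η ^K 2))
        w₃ = β
        w₄ = β *K η -K β *K (η ^K 2)
    in ((n : ℕ) → 1 ≤ n →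
          α (2 ℕ.* n) ≡ combo (u n) 0L (-L u (n ℕ.∸ 1)) 0L w₁ w₂ w₃ w₄)
     × ((n : ℕ) → 1 ≤ n →
          α (2 ℕ.* n ℕ.+ 1) ≡ combo (u (n ℕ.+ 1) +L u n) (u n) 0L (-L u (n ℕ.∸ 1)) w₁ w₂ w₃ w₄)
corollary2 d _ nonsquare γ _ η ε _ 0<Nη η²≡ε unit β _ =
  even-powers η²≡ε Nε≡1 , odd-powers η²≡ε Nε≡1
  where
  open QuadraticField d using (unit-norm; norm-of-square)
  open PowersOfUnit d γ η ε β using (even-powers; odd-powers)

  -- N(ε) = N(η) > 0, and ε is a unit, so N(ε) = 1
  Nε≡1 : LOps.normL d ε ≡ 1ℚ
  Nε≡1 = unit-norm ε unit (≡.subst (0ℚ <_) (norm-of-square nonsquare γ η ε η²≡ε) 0<Nη)
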